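{- In any Q-structure, for any facts $F,G,H$: $1\in(F\otimes G)\multimap H$ iff $1\in F\multimap(H\wp G^\perp)$.
   Context: A Q-structure is a tuple $\langle\mathcal P,\mathcal Z,\cdot,1\rangle$ with $\mathcal P$ a set, $\mathcal Z\subseteq\mathcal P$, $\cdot$ a binary operation on $\mathcal P$ (not assumed associative or commutative), and $1\in\mathcal P$. These satisfy, for all $x,y,z$: $x\cdot y\in\mathcal Z$ iff $y\cdot x\in\mathcal Z$; $(x\cdot y)\cdot z\in\mathcal Z$ iff $x\cdot(z\cdot y)\in\mathcal Z$; and $1\cdot x=x\cdot1=x$. For $A\subseteq\mathcal P$, $A^\perp=\{b: b\cdot a\in\mathcal Z\ \forall a\in A\}$. A fact is a subset $F$ with $F=(F^\perp)^\perp$. For $A,B\subseteq\mathcal P$, $A\cdot B=\{a\cdot b:a\in A,b\in B\}$. Operations on facts: - $F\otimes G=((F\cdot G)^\perp)^\perp$; - $F\wp G=(F^\perp\cdot G^\perp)^\perp$; - $F\multimap G=(F\cdot G^\perp)^\perp$. Linear negation is $\sim G=G^\perp$. -}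

module Defs where

open import Level using (Level; _⊔_; suc)
open import Data.Product using (Σ; ∃; _×_; _,_)
open import Relation.Binary.PropositionalEquality using (_≡_)
open import Function.Bundles using (_⇔_)

record QStructure (c z : Level) : Set (suc (c ⊔ z)) where
  infixl 7 _·_
  field
    P      : Set c
    Z      : P → Set z
    _·_    : P → P → P
    one    : P
    comm-Z : ∀ x y → Z (x · y) ⇔ Z (y · x)
    assoc-Z : ∀ x y w → Z ((x · y) · w) ⇔ Z (x · (w · y))
    unitˡ  : ∀ x → one · x ≡ x
    unitʳ  : ∀ x → x · one ≡ x

module QOps {c z : Level} (Q : QStructure c z) where
  open QStructure Q

  Subset : Set (suc (c ⊔ z))
  Subset = P → Set (c ⊔ z)

  _∈_ : P → Subset → Set (c ⊔ z)
  x ∈ A = A x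

  _⊥ : Subset → Subset
  (A ⊥) b = ∀ a → A a → Z (b · a)

  _··_ : Subset → Subset → Subset
  (A ·· B) x = Σ P λ a → Σ P λ b → A a × B b × (x ≡ a · b)

  IsFact : Subset → Set (c ⊔ z)
  IsFact F = ∀ x → F x ⇔ ((F ⊥) ⊥) x

  _⊗_ : Subset → Subset → Subset
  F ⊗ G = ((F ·· G) ⊥) ⊥

  _⅋_ : Subset → Subset → Subset
  F ⅋ G = ((F ⊥) ·· (G ⊥)) ⊥

  _⊸_ : Subset → Subset → Subset
  F ⊸ G = (F ·· (G ⊥)) ⊥

{-# OPTIONS --safe #-}
module Submission where

-- Write Orthogonal A B when a · b ∈ Z for all a ∈ A, b ∈ B.  Then 1 ∈ A ⊸ B says
-- exactly that A is orthogonal to B^⊥, orthogonality to A^⊥⊥ is orthogonality to A,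
-- and the associativity axiom on Z moves a factor across the pairing:
-- A · B ⟂ C iff A ⟂ C · B.  Both sides of the theorem thus reduce to F ⟂ H^⊥ · G,
-- the right-hand one after replacing the fact G by G^⊥⊥.

open import Defs
open import Level using (Level; _⊔_)
open import Data.Product using (_,_)
open import Function.Bundles using (_⇔_; mk⇔; Equivalence)
open import Function.Properties.Equivalence using (⇔-setoid)
open import Relation.Binary.PropositionalEquality using (refl; subst; sym)
import Relation.Binary.Reasoning.Setoid as SetoidReasoning

module Orthogonality {c z : Level} (Q : QStructure c z) where
  open QStructure Q
  open QOps Q
  open Equivalence using (to; from)

  Orthogonal : Subset → Subset → Set (c ⊔ z)
  Orthogonal A B = ∀ a b → A a → B b → Z (a · b)

  _≐_ : Subset → Subset → Set (c ⊔ z)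
  A ≐ B = ∀ x → A x ⇔ B x

  Z-comm : ∀ x y → Z (x · y) → Z (y · x)
  Z-comm x y = to (comm-Z x y)

  Orthogonal-sym : ∀ {A B} → Orthogonal A B → Orthogonal B A
  Orthogonal-sym A⟂B b a bB aA = Z-comm a b (A⟂B a b aA bB)

  ⊆-⊥⊥ : ∀ A x → A x → ((A ⊥) ⊥) x
  ⊆-⊥⊥ A x Ax b b∈A⊥ = Z-comm b x (b∈A⊥ x Ax)

  one∈⊥⇔Orthogonal : ∀ A B → one ∈ ((A ·· B) ⊥) ⇔ Orthogonal A B
  one∈⊥⇔Orthogonal A B = mk⇔ forward backward
    where
    forward : one ∈ ((A ·· B) ⊥) → Orthogonal A B
    forward one⟂ a b aA bB = subst Z (unitˡ (a · b)) (one⟂ (a · b) (a , b , aA , bB , refl))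

    backward : Orthogonal A B → one ∈ ((A ·· B) ⊥)
    backward A⟂B _ (a , b , aA , bB , refl) = subst Z (sym (unitˡ (a · b))) (A⟂B a b aA bB)

  Orthogonal-⊥⊥ˡ : ∀ A B → Orthogonal ((A ⊥) ⊥) B ⇔ Orthogonal A B
  Orthogonal-⊥⊥ˡ A B = mk⇔ forward backward
    where
    forward : Orthogonal ((A ⊥) ⊥) B → Orthogonal A B
    forward A⊥⊥⟂B a b aA = A⊥⊥⟂B a b (⊆-⊥⊥ A a aA)

    backward : Orthogonal A B → Orthogonal ((A ⊥) ⊥) B
    backward A⟂B t b t∈A⊥⊥ bB = t∈A⊥⊥ b (λ a aA → Z-comm a b (A⟂B a b aA bB))

  Orthogonal-⊥⊥ʳ : ∀ A B → Orthogonal A ((B ⊥) ⊥) ⇔ Orthogonal A B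
  Orthogonal-⊥⊥ʳ A B = mk⇔
    (λ A⟂B⊥⊥ → Orthogonal-sym (to (Orthogonal-⊥⊥ˡ B A) (Orthogonal-sym A⟂B⊥⊥)))
    (λ A⟂B → Orthogonal-sym (from (Orthogonal-⊥⊥ˡ B A) (Orthogonal-sym A⟂B)))

  Orthogonal-··-assoc : ∀ A B C → Orthogonal (A ·· B) C ⇔ Orthogonal A (C ·· B)
  Orthogonal-··-assoc A B C = mk⇔ forward backward
    where
    forward : Orthogonal (A ·· B) C → Orthogonal A (C ·· B)
    forward AB⟂C a _ aA (c , b , cC , bB , refl) =
      to (assoc-Z a b c) (AB⟂C (a · b) c (a , b , aA , bB , refl) cC)

    backward : Orthogonal A (C ·· B) → Orthogonal (A ·· B) C
    backward A⟂CB _ c (a , b , aA , bB , refl) cC =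
      from (assoc-Z a b c) (A⟂CB a (c · b) aA (c , b , cC , bB , refl))

  Orthogonal-··-congʳ : ∀ A C {B B′} → B ≐ B′ → Orthogonal A (C ·· B) ⇔ Orthogonal A (C ·· B′)
  Orthogonal-··-congʳ A C B≐B′ = mk⇔
    (λ A⟂CB a _ aA (c , b , cC , bB′ , e) → A⟂CB a _ aA (c , b , cC , from (B≐B′ b) bB′ , e))
    (λ A⟂CB′ a _ aA (c , b , cC , bB , e) → A⟂CB′ a _ aA (c , b , cC , to (B≐B′ b) bB , e))

lemma11 : {c z : Level} (Q : QStructure c z) →
    let open QOps Q in
    (F G H : Subset) → IsFact F → IsFact G → IsFact H →
    (QStructure.one Q ∈ ((F ⊗ G) ⊸ H)) ⇔ (QStructure.one Q ∈ (F ⊸ (H ⅋ (G ⊥))))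
lemma11 {c} {z} Q F G H _ G-fact _ = begin
  one ∈ ((F ⊗ G) ⊸ H)           ≈⟨ one∈⊥⇔Orthogonal (F ⊗ G) (H ⊥) ⟩
  Orthogonal (F ⊗ G) (H ⊥)      ≈⟨ Orthogonal-⊥⊥ˡ (F ·· G) (H ⊥) ⟩
  Orthogonal (F ·· G) (H ⊥)     ≈⟨ Orthogonal-··-assoc F G (H ⊥) ⟩
  Orthogonal F ((H ⊥) ·· G)     ≈⟨ Orthogonal-··-congʳ F (H ⊥) G-fact ⟩
  Orthogonal F ((H ⊥) ·· ((G ⊥) ⊥))
    ≈⟨ Orthogonal-⊥⊥ʳ F ((H ⊥) ·· ((G ⊥) ⊥)) ⟨
  Orthogonal F ((H ⅋ (G ⊥)) ⊥)  ≈⟨ one∈⊥⇔Orthogonal F ((H ⅋ (G ⊥)) ⊥) ⟨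
  one ∈ (F ⊸ (H ⅋ (G ⊥)))       ∎
  where
  open QStructure Q
  open QOps Q
  open Orthogonality Q
  open SetoidReasoning (⇔-setoid (c ⊔ z))
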